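{- Let $G$ be a graph with $m$ edges and maximum degree $\Delta$. Let $k$ be the number of edges $v_iv_j\in E(G)$ with $d_i=d_j$. Then $$ISDD(G)\leq \frac{k}{2}+\frac{\Delta(\Delta-1)}{\Delta^2+(\Delta-1)^2}\,(m-k).$$ Moreover, if $G$ is connected, equality holds if and only if $G$ is a regular graph, or $G$ is a $(\Delta,\Delta-1)$-semiregular bipartite graph, or $G\in\Gamma_2$.
   Context: For a simple graph $G$ with vertex degrees $d_i$, $ISDD(G)=\sum_{v_iv_j\in E(G)}\frac{d_id_j}{d_i^2+d_j^2}$. A bipartite graph with bipartition $U,W$ is an $(r,s)$-semiregular bipartite graph if every vertex of $U$ has degree $r$ and every vertex of $W$ has degree $s$. $\Gamma_2$ is the class of connected graphs $H$ with $m$ edges and maximum degree $\Delta$ such that $k>0$ edges $v_iv_j$ of $H$ satisfy $d_i=d_j=\Delta$ or $d_i=d_j=\Delta-1$, and the remaining $m-k>0$ edges have endpoint degrees $\{\Delta,\Delta-1\}$. -}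

module Defs where

open import Data.Nat as ℕ using (ℕ; zero; suc; _⊔_; _∸_; _<ᵇ_; _≡ᵇ_)
open import Data.Fin using (Fin; toℕ)
open import Data.Bool using (Bool; true; false; if_then_else_; _∧_)
open import Data.List using (List; map; foldr; allFin)
open import Data.Integer using (+_)
open import Data.Rational as ℚ using (ℚ; 0ℚ; _+_; _*_; _/_)
open import Data.Product using (_×_)
open import Data.Sum using (_⊎_)
open import Relation.Binary.PropositionalEquality using (_≡_)
import Data.Product
import Data.Bool

record Graph : Set where
  field
    n      : ℕ
    adj    : Fin n → Fin n → Bool
    sym    : ∀ i j → adj i j ≡ adj j i
    irrefl : ∀ i → adj i i ≡ false
open Graph public

sumℕ : List ℕ → ℕ
sumℕ = foldr ℕ._+_ 0

sumℚ : List ℚ → ℚ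
sumℚ = foldr _+_ 0ℚ

deg : (G : Graph) → Fin (n G) → ℕ
deg G i = sumℕ (map (λ j → if adj G i j then 1 else 0) (allFin (n G)))

maxDeg : Graph → ℕ
maxDeg G = foldr _⊔_ 0 (map (deg G) (allFin (n G)))

-- is {i,j} an edge, counted once (toℕ i < toℕ j)
isEdge : (G : Graph) → Fin (n G) → Fin (n G) → Bool
isEdge G i j = adj G i j ∧ (toℕ i <ᵇ toℕ j)

countEdges : (G : Graph) → (Fin (n G) → Fin (n G) → Bool) → ℕ
countEdges G P = sumℕ (map (λ i → sumℕ (map (λ j →
  if isEdge G i j ∧ P i j then 1 else 0) (allFin (n G)))) (allFin (n G)))

sumEdges : (G : Graph) → (Fin (n G) → Fin (n G) → ℚ) → ℚ
sumEdges G f = sumℚ (map (λ i → sumℚ (map (λ j →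
  if isEdge G i j then f i j else 0ℚ) (allFin (n G)))) (allFin (n G)))

numEdges : Graph → ℕ
numEdges G = countEdges G (λ _ _ → true)

numEqEdges : (G : Graph) → ℕ
numEqEdges G = countEdges G (λ i j → deg G i ≡ᵇ deg G j)

-- a / b as a rational; b = 0 gives 0 (never used on edges, where
-- the denominators are positive)
frac : ℕ → ℕ → ℚ
frac a zero    = 0ℚ
frac a (suc b) = (+ a) / suc b

ISDD : Graph → ℚ
ISDD G = sumEdges G (λ i j →
  frac (deg G i ℕ.* deg G j) (deg G i ℕ.* deg G i ℕ.+ deg G j ℕ.* deg G j))

data Reachable (G : Graph) : Fin (n G) → Fin (n G) → Set where
  here : ∀ {i} → Reachable G i i
  step : ∀ {i j k} → adj G i j ≡ true → Reachable G j k → Reachable G i k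

Connected : Graph → Set
Connected G = ∀ i j → Reachable G i j

Regular : Graph → Set
Regular G = ∀ i j → deg G i ≡ deg G j

-- (r,s)-semiregular bipartite: a bipartition (colour true = U, false = W)
-- such that every edge joins U and W, vertices in U have degree r and
-- vertices in W have degree s.
SemiregularBipartite : (G : Graph) → ℕ → ℕ → Set
SemiregularBipartite G r s =
  Data.Product.Σ (Fin (n G) → Bool) λ c →
    (∀ i j → adj G i j ≡ true → c i ≡ Data.Bool.not (c j))
    × (∀ i → c i ≡ true → deg G i ≡ r)
    × (∀ i → c i ≡ false → deg G i ≡ s)

-- the class Γ₂ (connectedness is assumed separately in the theorem):
-- with Δ the maximum degree and k the number of edges with equal end degrees,
-- k > 0, m - k > 0, and every edge has end degrees (Δ,Δ), (Δ-1,Δ-1),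
-- or {Δ, Δ-1}.
InΓ₂ : Graph → Set
InΓ₂ G =
  (0 ℕ.< numEqEdges G) × (0 ℕ.< numEdges G ∸ numEqEdges G)
  × (∀ i j → adj G i j ≡ true →
       (deg G i ≡ Δ × deg G j ≡ Δ)
     ⊎ (deg G i ≡ Δ ∸ 1 × deg G j ≡ Δ ∸ 1)
     ⊎ (deg G i ≡ Δ × deg G j ≡ Δ ∸ 1)
     ⊎ (deg G i ≡ Δ ∸ 1 × deg G j ≡ Δ))
  where Δ = maxDeg G

isddBound : Graph → ℚ
isddBound G =
  ((+ k) / 2) + frac (Δ ℕ.* (Δ ∸ 1)) (Δ ℕ.* Δ ℕ.+ (Δ ∸ 1) ℕ.* (Δ ∸ 1))
                * ((+ (m ∸ k)) / 1)
  where
    Δ = maxDeg G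
    m = numEdges G
    k = numEqEdges G

module Submission where

-- An edge with end degrees x, y contributes xy/(x² + y²) = 1/(t + 1/t), t = y/x, which decreases
-- as t moves away from 1.  For x = y this is 1/2.  For x < y ≤ Δ we have t ≥ Δ/(Δ - 1), so the
-- contribution is at most Δ(Δ - 1)/(Δ² + (Δ - 1)²), with equality only for (x, y) = (Δ - 1, Δ).
-- Summing over the edges gives the bound, and equality forces every edge to be of one of these
-- two kinds.  In a connected graph all of whose edges are of these kinds, either every edge has
-- equal ends, so the degree is constant and the graph is regular, or the degrees {Δ - 1, Δ} of
-- an unequal edge propagate along edges to every vertex; the graph is then (Δ, Δ - 1)-semiregular
-- bipartite if no edge has equal ends, and lies in Γ₂ otherwise.

open import Defs hiding (sym)
open import Data.Rational using (_≤_)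
open import Data.Product using (_×_)
open import Data.Sum using (_⊎_)
open import Function.Bundles using (_⇔_)
open import Relation.Binary.PropositionalEquality using (_≡_)
import Data.Nat

open import Data.Bool using (Bool; true; false; if_then_else_; not; _∧_; T)
open import Data.Bool.Properties using (not-injective; ∧-conicalˡ; T-≡)
open import Data.Fin using (Fin; toℕ)
open import Data.Fin.Properties using (toℕ-injective)
open import Data.Integer as ℤ using (+_)
import Data.Integer.Properties as ℤₚ
import Data.Integer.Tactic.RingSolver as ℤ-Solver
open import Data.List using (List; []; _∷_; map; foldr; allFin)
open import Data.List.Properties using (map-cong)
open import Data.List.Membership.Propositional using (_∈_)
open import Data.List.Membership.Propositional.Properties using (∈-allFin)
open import Data.List.Relation.Unary.Any using (here; there)
open import Data.Nat as ℕ using (ℕ; zero; suc; _∸_; _⊔_; _≡ᵇ_; z≤n; s≤s)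
import Data.Nat.Properties as ℕₚ
open import Data.Nat.Tactic.RingSolver using (solve-∀)
open import Data.Product using (_,_; ∃; ∃₂)
open import Data.Rational using (ℚ; 0ℚ; _+_; _*_; _/_; _<_; toℚᵘ; fromℚᵘ)
import Data.Rational.Properties as ℚₚ
open import Data.Rational.Solver using (module +-*-Solver)
open import Data.Rational.Unnormalised as ℚᵘ using (mkℚᵘ; _≃_; *≡*; *≤*; *<*)
import Data.Rational.Unnormalised.Properties as ℚᵘₚ
open import Data.Sum using (inj₁; inj₂)
open import Function.Bundles using (mk⇔; Equivalence)
import Function.Properties.Equivalence as ⇔
open import Relation.Binary.Definitions using (tri<; tri≈; tri>)
open import Relation.Binary.PropositionalEquality
  using (_≢_; ≢-sym; refl; sym; trans; cong; cong₂; subst; subst₂; module ≡-Reasoning)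
open import Relation.Nullary using (contradiction; yes; no)
open import Relation.Nullary.Reflects using (Reflects; ofʸ; ofⁿ; fromEquivalence)

fromℕ : ℕ → ℚ
fromℕ n = + n / 1

½ : ℚ
½ = + 1 / 2

fromℚᵘ-+ : ∀ p q → fromℚᵘ (p ℚᵘ.+ q) ≡ fromℚᵘ p + fromℚᵘ q
fromℚᵘ-+ p q = ℚₚ.toℚᵘ-injective (ℚᵘₚ.≃-trans (ℚₚ.toℚᵘ-fromℚᵘ (p ℚᵘ.+ q))
  (ℚᵘₚ.≃-sym (ℚᵘₚ.≃-trans (ℚₚ.toℚᵘ-homo-+ (fromℚᵘ p) (fromℚᵘ q))
    (ℚᵘₚ.+-cong (ℚₚ.toℚᵘ-fromℚᵘ p) (ℚₚ.toℚᵘ-fromℚᵘ q)))))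

fromℚᵘ-* : ∀ p q → fromℚᵘ (p ℚᵘ.* q) ≡ fromℚᵘ p * fromℚᵘ q
fromℚᵘ-* p q = ℚₚ.toℚᵘ-injective (ℚᵘₚ.≃-trans (ℚₚ.toℚᵘ-fromℚᵘ (p ℚᵘ.* q))
  (ℚᵘₚ.≃-sym (ℚᵘₚ.≃-trans (ℚₚ.toℚᵘ-homo-* (fromℚᵘ p) (fromℚᵘ q))
    (ℚᵘₚ.*-cong (ℚₚ.toℚᵘ-fromℚᵘ p) (ℚₚ.toℚᵘ-fromℚᵘ q)))))

fromℕ-+ : ∀ a b → fromℕ (a ℕ.+ b) ≡ fromℕ a + fromℕ b
fromℕ-+ a b = trans
  (ℚₚ.fromℚᵘ-cong {mkℚᵘ (+ (a ℕ.+ b)) 0} {mkℚᵘ (+ a) 0 ℚᵘ.+ mkℚᵘ (+ b) 0} (*≡* cross))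
  (fromℚᵘ-+ (mkℚᵘ (+ a) 0) (mkℚᵘ (+ b) 0))
  where
  distrib : ∀ (x y : ℤ.ℤ) → (x ℤ.+ y) ℤ.* + 1 ≡ (x ℤ.* + 1 ℤ.+ y ℤ.* + 1) ℤ.* + 1
  distrib = ℤ-Solver.solve-∀
  cross : + (a ℕ.+ b) ℤ.* + 1 ≡ (+ a ℤ.* + 1 ℤ.+ + b ℤ.* + 1) ℤ.* + 1
  cross = trans (cong (ℤ._* + 1) (ℤₚ.pos-+ a b)) (distrib (+ a) (+ b))

½*fromℕ : ∀ k → ½ * fromℕ k ≡ + k / 2
½*fromℕ k = trans (sym (fromℚᵘ-* (mkℚᵘ (+ 1) 1) (mkℚᵘ (+ k) 0)))
  (ℚₚ.fromℚᵘ-cong {mkℚᵘ (+ 1) 1 ℚᵘ.* mkℚᵘ (+ k) 0} {mkℚᵘ (+ k) 1} (*≡* (cross (+ k))))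
  where
  cross : ∀ (x : ℤ.ℤ) → (+ 1 ℤ.* x) ℤ.* + 2 ≡ x ℤ.* + 2
  cross = ℤ-Solver.solve-∀

toℚᵘ-frac : ∀ a b → toℚᵘ (frac a (suc b)) ≃ mkℚᵘ (+ a) b
toℚᵘ-frac a b = ℚₚ.toℚᵘ-fromℚᵘ (mkℚᵘ (+ a) b)

cross-≤⇒frac-≤ : ∀ a b c d → 0 ℕ.< b → 0 ℕ.< d → a ℕ.* d ℕ.≤ c ℕ.* b → frac a b ≤ frac c d
cross-≤⇒frac-≤ a (suc b) c (suc d) _ _ ad≤cb = ℚₚ.toℚᵘ-cancel-≤
  (ℚᵘₚ.≤-respˡ-≃ (ℚᵘₚ.≃-sym (toℚᵘ-frac a b)) (ℚᵘₚ.≤-respʳ-≃ (ℚᵘₚ.≃-sym (toℚᵘ-frac c d))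
    (*≤* (subst₂ ℤ._≤_ (ℤₚ.pos-* a (suc d)) (ℤₚ.pos-* c (suc b)) (ℤ.+≤+ ad≤cb)))))

cross-<⇒frac-< : ∀ a b c d → 0 ℕ.< b → 0 ℕ.< d → a ℕ.* d ℕ.< c ℕ.* b → frac a b < frac c d
cross-<⇒frac-< a (suc b) c (suc d) _ _ ad<cb = ℚₚ.toℚᵘ-cancel-<
  (ℚᵘₚ.<-respˡ-≃ (ℚᵘₚ.≃-sym (toℚᵘ-frac a b)) (ℚᵘₚ.<-respʳ-≃ (ℚᵘₚ.≃-sym (toℚᵘ-frac c d))
    (*<* (subst₂ ℤ._<_ (ℤₚ.pos-* a (suc d)) (ℤₚ.pos-* c (suc b)) (ℤ.+<+ ad<cb)))))

cross-≡⇒frac-≡ : ∀ a b c d → 0 ℕ.< b → 0 ℕ.< d → a ℕ.* d ≡ c ℕ.* b → frac a b ≡ frac c d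
cross-≡⇒frac-≡ a b c d 0<b 0<d ad≡cb = ℚₚ.≤-antisym
  (cross-≤⇒frac-≤ a b c d 0<b 0<d (ℕₚ.≤-reflexive ad≡cb))
  (cross-≤⇒frac-≤ c d a b 0<d 0<b (ℕₚ.≤-reflexive (sym ad≡cb)))

frac-≡⇒cross-≡ : ∀ a b c d → 0 ℕ.< b → 0 ℕ.< d → frac a b ≡ frac c d → a ℕ.* d ≡ c ℕ.* b
frac-≡⇒cross-≡ a b c d 0<b 0<d eq with ℕₚ.<-cmp (a ℕ.* d) (c ℕ.* b)
... | tri< ad<cb _ _ = contradiction eq (ℚₚ.<⇒≢ (cross-<⇒frac-< a b c d 0<b 0<d ad<cb))
... | tri≈ _ ad≡cb _ = ad≡cb
... | tri> _ _ cb<ad = contradiction (sym eq) (ℚₚ.<⇒≢ (cross-<⇒frac-< c d a b 0<d 0<b cb<ad))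

isdd : ℕ → ℕ → ℚ
isdd x y = frac (x ℕ.* y) (x ℕ.* x ℕ.+ y ℕ.* y)

isdd-comm : ∀ x y → isdd x y ≡ isdd y x
isdd-comm x y = cong₂ frac (ℕₚ.*-comm x y) (ℕₚ.+-comm (x ℕ.* x) (y ℕ.* y))

squares-posˡ : ∀ {x} y → 0 ℕ.< x → 0 ℕ.< x ℕ.* x ℕ.+ y ℕ.* y
squares-posˡ {suc _} _ _ = s≤s z≤n

squares-posʳ : ∀ x {y} → 0 ℕ.< y → 0 ℕ.< x ℕ.* x ℕ.+ y ℕ.* y
squares-posʳ x {y} 0<y = subst (0 ℕ.<_) (ℕₚ.+-comm (y ℕ.* y) (x ℕ.* x)) (squares-posˡ x 0<y)

isdd-diag : ∀ {x} → 0 ℕ.< x → isdd x x ≡ ½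
isdd-diag {x} 0<x = cross-≡⇒frac-≡ _ _ 1 2 (squares-posˡ x 0<x) (s≤s z≤n) (cross x)
  where
  cross : ∀ x → x ℕ.* x ℕ.* 2 ≡ 1 ℕ.* (x ℕ.* x ℕ.+ x ℕ.* x)
  cross = solve-∀

-- Write y = x + 1 + p and Δ = y + q.  Cross-multiplying isdd x y ≤ isdd Δ (Δ - 1) leaves the
-- slack (pΔ + q)(Δ(p + 1) + x), which vanishes exactly when p = q = 0.
cross-slack : ∀ x p q →
  x ℕ.* suc (x ℕ.+ p) ℕ.* (suc (x ℕ.+ p ℕ.+ q) ℕ.* suc (x ℕ.+ p ℕ.+ q) ℕ.+ (x ℕ.+ p ℕ.+ q) ℕ.* (x ℕ.+ p ℕ.+ q))
    ℕ.+ (p ℕ.* suc (x ℕ.+ p ℕ.+ q) ℕ.+ q) ℕ.* (suc (x ℕ.+ p ℕ.+ q) ℕ.* suc p ℕ.+ x)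
  ≡ suc (x ℕ.+ p ℕ.+ q) ℕ.* (x ℕ.+ p ℕ.+ q) ℕ.* (x ℕ.* x ℕ.+ suc (x ℕ.+ p) ℕ.* suc (x ℕ.+ p))
cross-slack = solve-∀

slack≡0⇒ : ∀ x p q →
  (p ℕ.* suc (x ℕ.+ p ℕ.+ q) ℕ.+ q) ℕ.* (suc (x ℕ.+ p ℕ.+ q) ℕ.* suc p ℕ.+ x) ≡ 0 → p ≡ 0 × q ≡ 0
slack≡0⇒ x p q slack≡0 =
  ℕₚ.m*n≡0⇒m≡0 p (suc (x ℕ.+ p ℕ.+ q)) (ℕₚ.m+n≡0⇒m≡0 _ pΔ+q≡0) , ℕₚ.m+n≡0⇒n≡0 _ pΔ+q≡0
  where
  pΔ+q≡0 : p ℕ.* suc (x ℕ.+ p ℕ.+ q) ℕ.+ q ≡ 0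
  pΔ+q≡0 = ℕₚ.m*n≡0⇒m≡0 _ _ slack≡0

isdd-cross-≤ : ∀ x y u v → 0 ℕ.< y → 0 ℕ.< u →
  x ℕ.* y ℕ.* (u ℕ.* u ℕ.+ v ℕ.* v) ℕ.≤ u ℕ.* v ℕ.* (x ℕ.* x ℕ.+ y ℕ.* y) → isdd x y ≤ isdd u v
isdd-cross-≤ x y u v 0<y 0<u =
  cross-≤⇒frac-≤ (x ℕ.* y) _ (u ℕ.* v) _ (squares-posʳ x 0<y) (squares-posˡ v 0<u)

isdd-≡⇒cross : ∀ x y u v → 0 ℕ.< y → 0 ℕ.< u → isdd x y ≡ isdd u v →
  x ℕ.* y ℕ.* (u ℕ.* u ℕ.+ v ℕ.* v) ≡ u ℕ.* v ℕ.* (x ℕ.* x ℕ.+ y ℕ.* y)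
isdd-≡⇒cross x y u v 0<y 0<u =
  frac-≡⇒cross-≡ (x ℕ.* y) _ (u ℕ.* v) _ (squares-posʳ x 0<y) (squares-posˡ v 0<u)

isdd-<-bound : ∀ {x y Δ} → x ℕ.< y → y ℕ.≤ Δ → isdd x y ≤ isdd Δ (Δ ∸ 1)
isdd-<-bound {x} x<y y≤Δ with ℕₚ.m≤n⇒∃[o]m+o≡n x<y | ℕₚ.m≤n⇒∃[o]m+o≡n y≤Δ
... | p , refl | q , refl =
  isdd-cross-≤ x (suc (x ℕ.+ p)) (suc (x ℕ.+ p ℕ.+ q)) (x ℕ.+ p ℕ.+ q) (s≤s z≤n) (s≤s z≤n)
    (ℕₚ.m+n≤o⇒m≤o _ (ℕₚ.≤-reflexive (cross-slack x p q)))

isdd-<-tight : ∀ {x y Δ} → x ℕ.< y → y ℕ.≤ Δ → isdd x y ≡ isdd Δ (Δ ∸ 1) → x ≡ Δ ∸ 1 × y ≡ Δ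
isdd-<-tight {x} x<y y≤Δ eq with ℕₚ.m≤n⇒∃[o]m+o≡n x<y | ℕₚ.m≤n⇒∃[o]m+o≡n y≤Δ
... | p , refl | q , refl
  with slack≡0⇒ x p q (ℕₚ.+-cancelˡ-≡ _ _ 0 (trans (cross-slack x p q) (trans
         (sym (isdd-≡⇒cross x (suc (x ℕ.+ p)) (suc (x ℕ.+ p ℕ.+ q)) (x ℕ.+ p ℕ.+ q) (s≤s z≤n) (s≤s z≤n) eq))
         (sym (ℕₚ.+-identityʳ _)))))
... | refl , refl = sym (trans (ℕₚ.+-identityʳ (x ℕ.+ 0)) (ℕₚ.+-identityʳ x))
                  , cong suc (sym (ℕₚ.+-identityʳ (x ℕ.+ 0)))

≡ᵇ-reflects : ∀ x y → Reflects (x ≡ y) (x ≡ᵇ y)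
≡ᵇ-reflects x y = fromEquivalence (ℕₚ.≡ᵇ⇒≡ x y) (ℕₚ.≡⇒≡ᵇ x y)

≡ᵇ≡true⇒≡ : ∀ {x y} → (x ≡ᵇ y) ≡ true → x ≡ y
≡ᵇ≡true⇒≡ {x} {y} e = ℕₚ.≡ᵇ⇒≡ x y (subst T (sym e) _)

≡ᵇ≡false⇒≢ : ∀ {x y} → (x ≡ᵇ y) ≡ false → x ≢ y
≡ᵇ≡false⇒≢ {x} {y} e x≡y = subst T e (ℕₚ.≡⇒≡ᵇ x y x≡y)

edgeBound : ℕ → ℕ → ℕ → ℚ
edgeBound Δ x y = if x ≡ᵇ y then ½ else isdd Δ (Δ ∸ 1)

Extremal : ℕ → ℕ → ℕ → Set
Extremal Δ x y = x ≡ y ⊎ (x ≡ Δ × y ≡ Δ ∸ 1) ⊎ (x ≡ Δ ∸ 1 × y ≡ Δ)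

NearMax : ℕ → ℕ → Set
NearMax Δ x = x ≡ Δ ⊎ x ≡ Δ ∸ 1

isdd≤edgeBound : ∀ Δ {x y} → 0 ℕ.< x → x ℕ.≤ Δ → y ℕ.≤ Δ → isdd x y ≤ edgeBound Δ x y
isdd≤edgeBound Δ {x} {y} 0<x x≤Δ y≤Δ with x ≡ᵇ y | ≡ᵇ-reflects x y
... | true  | ofʸ refl = ℚₚ.≤-reflexive (isdd-diag 0<x)
... | false | ofⁿ x≢y with ℕₚ.<-cmp x y
...   | tri< x<y _ _ = isdd-<-bound x<y y≤Δ
...   | tri≈ _ x≡y _ = contradiction x≡y x≢y
...   | tri> _ _ y<x = subst (_≤ isdd Δ (Δ ∸ 1)) (isdd-comm y x) (isdd-<-bound y<x x≤Δ)

isdd≡edgeBound⇒Extremal : ∀ Δ {x y} → x ℕ.≤ Δ → y ℕ.≤ Δ → isdd x y ≡ edgeBound Δ x y → Extremal Δ x y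
isdd≡edgeBound⇒Extremal Δ {x} {y} x≤Δ y≤Δ eq with x ≡ᵇ y | ≡ᵇ-reflects x y
... | true  | ofʸ x≡y = inj₁ x≡y
... | false | ofⁿ x≢y with ℕₚ.<-cmp x y
...   | tri< x<y _ _ = inj₂ (inj₂ (isdd-<-tight x<y y≤Δ eq))
...   | tri≈ _ x≡y _ = contradiction x≡y x≢y
...   | tri> _ _ y<x with isdd-<-tight y<x x≤Δ (trans (isdd-comm y x) eq)
...     | y≡Δ∸1 , x≡Δ = inj₂ (inj₁ (x≡Δ , y≡Δ∸1))

Extremal⇒isdd≡edgeBound : ∀ Δ {x y} → 0 ℕ.< x → Extremal Δ x y → isdd x y ≡ edgeBound Δ x y
Extremal⇒isdd≡edgeBound Δ {x} {y} 0<x ext with x ≡ᵇ y | ≡ᵇ-reflects x y | ext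
... | true  | ofʸ refl | _                         = isdd-diag 0<x
... | false | ofⁿ x≢y  | inj₁ x≡y                  = contradiction x≡y x≢y
... | false | ofⁿ _    | inj₂ (inj₁ (refl , refl)) = refl
... | false | ofⁿ _    | inj₂ (inj₂ (refl , refl)) = isdd-comm (Δ ∸ 1) Δ

Extremal-sym : ∀ {Δ x y} → Extremal Δ x y → Extremal Δ y x
Extremal-sym (inj₁ x≡y)             = inj₁ (sym x≡y)
Extremal-sym (inj₂ (inj₁ (p , q))) = inj₂ (inj₂ (q , p))
Extremal-sym (inj₂ (inj₂ (p , q))) = inj₂ (inj₁ (q , p))

Extremal⇒NearMax : ∀ {Δ x y} → Extremal Δ x y → x ≢ y → NearMax Δ x
Extremal⇒NearMax (inj₁ x≡y)              x≢y = contradiction x≡y x≢y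
Extremal⇒NearMax (inj₂ (inj₁ (x≡Δ , _)))   _ = inj₁ x≡Δ
Extremal⇒NearMax (inj₂ (inj₂ (x≡Δ∸1 , _))) _ = inj₂ x≡Δ∸1

NearMax-closed : ∀ {Δ x y} → Extremal Δ x y → NearMax Δ y → NearMax Δ x
NearMax-closed (inj₁ refl)                near = near
NearMax-closed (inj₂ (inj₁ (x≡Δ , _)))      _ = inj₁ x≡Δ
NearMax-closed (inj₂ (inj₂ (x≡Δ∸1 , _)))    _ = inj₂ x≡Δ∸1

NearMax-≢⇒≡∸1 : ∀ {Δ x} → NearMax Δ x → x ≢ Δ → x ≡ Δ ∸ 1
NearMax-≢⇒≡∸1 (inj₁ x≡Δ)   x≢Δ = contradiction x≡Δ x≢Δ
NearMax-≢⇒≡∸1 (inj₂ x≡Δ∸1) _   = x≡Δ∸1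

NearMax-pair : ∀ {Δ x y} → NearMax Δ x → NearMax Δ y →
  (x ≡ Δ × y ≡ Δ) ⊎ (x ≡ Δ ∸ 1 × y ≡ Δ ∸ 1) ⊎ (x ≡ Δ × y ≡ Δ ∸ 1) ⊎ (x ≡ Δ ∸ 1 × y ≡ Δ)
NearMax-pair (inj₁ p) (inj₁ q) = inj₁ (p , q)
NearMax-pair (inj₂ p) (inj₂ q) = inj₂ (inj₁ (p , q))
NearMax-pair (inj₁ p) (inj₂ q) = inj₂ (inj₂ (inj₁ (p , q)))
NearMax-pair (inj₂ p) (inj₁ q) = inj₂ (inj₂ (inj₂ (p , q)))

module _ {A : Set} where

  ≤-sumℕ : (f : A → ℕ) {x : A} (xs : List A) → x ∈ xs → f x ℕ.≤ sumℕ (map f xs)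
  ≤-sumℕ f (x ∷ xs) (here refl) = ℕₚ.m≤m+n (f x) _
  ≤-sumℕ f (y ∷ xs) (there x∈xs) = ℕₚ.≤-trans (≤-sumℕ f xs x∈xs) (ℕₚ.m≤n+m _ (f y))

  ≤-foldr-⊔ : (f : A → ℕ) {x : A} (xs : List A) → x ∈ xs → f x ℕ.≤ foldr _⊔_ 0 (map f xs)
  ≤-foldr-⊔ f (x ∷ xs) (here refl) = ℕₚ.m≤m⊔n (f x) _
  ≤-foldr-⊔ f (y ∷ xs) (there x∈xs) = ℕₚ.≤-trans (≤-foldr-⊔ f xs x∈xs) (ℕₚ.m≤n⊔m (f y) _)

  sumℕ>0⇒ : (f : A → ℕ) (xs : List A) → 0 ℕ.< sumℕ (map f xs) → ∃ λ x → 0 ℕ.< f x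
  sumℕ>0⇒ f (x ∷ xs) pos with f x in fx≡
  ... | suc _ = x , subst (0 ℕ.<_) (sym fx≡) (s≤s z≤n)
  ... | zero  = sumℕ>0⇒ f xs pos

  sumℕ-+ : (f g : A → ℕ) (xs : List A) →
    sumℕ (map (λ x → f x ℕ.+ g x) xs) ≡ sumℕ (map f xs) ℕ.+ sumℕ (map g xs)
  sumℕ-+ f g []       = refl
  sumℕ-+ f g (x ∷ xs) = trans (cong (f x ℕ.+ g x ℕ.+_) (sumℕ-+ f g xs))
                              (interchange (f x) (g x) (sumℕ (map f xs)) (sumℕ (map g xs)))
    where
    interchange : ∀ a b c d → a ℕ.+ b ℕ.+ (c ℕ.+ d) ≡ a ℕ.+ c ℕ.+ (b ℕ.+ d)
    interchange = solve-∀

  sumℚ-mono : (f g : A → ℚ) → (∀ x → f x ≤ g x) → ∀ xs → sumℚ (map f xs) ≤ sumℚ (map g xs)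
  sumℚ-mono f g f≤g []       = ℚₚ.≤-refl
  sumℚ-mono f g f≤g (x ∷ xs) = ℚₚ.+-mono-≤ (f≤g x) (sumℚ-mono f g f≤g xs)

  sumℚ-mono-< : (f g : A → ℚ) → (∀ x → f x ≤ g x) → ∀ {x} xs → x ∈ xs → f x < g x →
    sumℚ (map f xs) < sumℚ (map g xs)
  sumℚ-mono-< f g f≤g (x ∷ xs) (here refl)  fx<gx = ℚₚ.+-mono-<-≤ fx<gx (sumℚ-mono f g f≤g xs)
  sumℚ-mono-< f g f≤g (y ∷ xs) (there x∈xs) fx<gx =
    ℚₚ.+-mono-≤-< (f≤g y) (sumℚ-mono-< f g f≤g xs x∈xs fx<gx)

  sumℚ-linear : (a b : ℚ) (f g : A → ℕ) (xs : List A) →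
    sumℚ (map (λ x → a * fromℕ (f x) + b * fromℕ (g x)) xs)
      ≡ a * fromℕ (sumℕ (map f xs)) + b * fromℕ (sumℕ (map g xs))
  sumℚ-linear a b f g [] = sym (trans (cong₂ _+_ (ℚₚ.*-zeroʳ a) (ℚₚ.*-zeroʳ b)) (ℚₚ.+-identityʳ 0ℚ))
  sumℚ-linear a b f g (x ∷ xs) = begin
    a * fromℕ (f x) + b * fromℕ (g x) + sumℚ (map (λ x → a * fromℕ (f x) + b * fromℕ (g x)) xs)
      ≡⟨ cong (_+_ (a * fromℕ (f x) + b * fromℕ (g x))) (sumℚ-linear a b f g xs) ⟩
    a * fromℕ (f x) + b * fromℕ (g x) + (a * fromℕ (sumℕ (map f xs)) + b * fromℕ (sumℕ (map g xs)))
      ≡⟨ regroup a b (fromℕ (f x)) (fromℕ (g x)) (fromℕ (sumℕ (map f xs))) (fromℕ (sumℕ (map g xs))) ⟩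
    a * (fromℕ (f x) + fromℕ (sumℕ (map f xs))) + b * (fromℕ (g x) + fromℕ (sumℕ (map g xs)))
      ≡⟨ sym (cong₂ (λ s t → a * s + b * t) (fromℕ-+ (f x) _) (fromℕ-+ (g x) _)) ⟩
    a * fromℕ (sumℕ (map f (x ∷ xs))) + b * fromℕ (sumℕ (map g (x ∷ xs))) ∎
    where
    open ≡-Reasoning
    open +-*-Solver using (solve; _:+_; _:*_; _:=_)
    regroup : ∀ a b p q r s → a * p + b * q + (a * r + b * s) ≡ a * (p + r) + b * (q + s)
    regroup = solve 6 (λ a b p q r s →
      a :* p :+ b :* q :+ (a :* r :+ b :* s) := a :* (p :+ r) :+ b :* (q :+ s)) refl

module _ (G : Graph) where
  private
    V : List (Fin (n G))
    V = allFin (n G)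
    d : Fin (n G) → ℕ
    d = deg G
    Δ : ℕ
    Δ = maxDeg G

  deg≤maxDeg : ∀ i → d i ℕ.≤ Δ
  deg≤maxDeg i = ≤-foldr-⊔ d V (∈-allFin i)

  adj⇒deg>0 : ∀ {i j} → adj G i j ≡ true → 0 ℕ.< d i
  adj⇒deg>0 {i} {j} a = subst (λ b → (if b then 1 else 0) ℕ.≤ d i) a
    (≤-sumℕ (λ j → if adj G i j then 1 else 0) V (∈-allFin j))

  adj-sym : ∀ {i j} → adj G i j ≡ true → adj G j i ≡ true
  adj-sym {i} {j} a = trans (Graph.sym G j i) a

  isEdge⇒adj : ∀ {i j} → isEdge G i j ≡ true → adj G i j ≡ true
  isEdge⇒adj e = ∧-conicalˡ _ _ e

  adj⇒isEdge : ∀ {i j} → adj G i j ≡ true → isEdge G i j ≡ true ⊎ isEdge G j i ≡ true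
  adj⇒isEdge {i} {j} a with ℕₚ.<-cmp (toℕ i) (toℕ j)
  ... | tri< i<j _ _ rewrite a = inj₁ (Equivalence.to T-≡ (ℕₚ.<⇒<ᵇ i<j))
  ... | tri≈ _ i≡j _ rewrite toℕ-injective i≡j = contradiction (trans (sym a) (irrefl G j)) λ ()
  ... | tri> _ _ j<i rewrite adj-sym a = inj₂ (Equivalence.to T-≡ (ℕₚ.<⇒<ᵇ j<i))

  private
    edgeTerm : (Fin (n G) → Fin (n G) → ℚ) → Fin (n G) → Fin (n G) → ℚ
    edgeTerm f i j = if isEdge G i j then f i j else 0ℚ

    edgeTerm-mono : ∀ {f g} → (∀ i j → isEdge G i j ≡ true → f i j ≤ g i j) →
      ∀ i j → edgeTerm f i j ≤ edgeTerm g i j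
    edgeTerm-mono f≤g i j with isEdge G i j in e
    ... | true  = f≤g i j e
    ... | false = ℚₚ.≤-refl

  sumEdges-mono : ∀ {f g} → (∀ i j → isEdge G i j ≡ true → f i j ≤ g i j) → sumEdges G f ≤ sumEdges G g
  sumEdges-mono {f} {g} f≤g =
    sumℚ-mono _ _ (λ i → sumℚ-mono (edgeTerm f i) (edgeTerm g i) (edgeTerm-mono f≤g i) V) V

  sumEdges-mono-< : ∀ {f g} → (∀ i j → isEdge G i j ≡ true → f i j ≤ g i j) →
    ∀ {i j} → isEdge G i j ≡ true → f i j < g i j → sumEdges G f < sumEdges G g
  sumEdges-mono-< {f} {g} f≤g {i} {j} e fij<gij =
    sumℚ-mono-< _ _ (λ i → sumℚ-mono (edgeTerm f i) (edgeTerm g i) (edgeTerm-mono f≤g i) V)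
      V (∈-allFin i)
      (sumℚ-mono-< (edgeTerm f i) (edgeTerm g i) (edgeTerm-mono f≤g i) V (∈-allFin j)
        (subst (λ b → (if b then f i j else 0ℚ) < (if b then g i j else 0ℚ)) (sym e) fij<gij))

  sumEdges-≡⇒≡ : ∀ {f g} → (∀ i j → isEdge G i j ≡ true → f i j ≤ g i j) →
    sumEdges G f ≡ sumEdges G g → ∀ {i j} → isEdge G i j ≡ true → f i j ≡ g i j
  sumEdges-≡⇒≡ f≤g eq {i} {j} e = ℚₚ.≤-antisym (f≤g i j e)
    (ℚₚ.≮⇒≥ λ fij<gij → ℚₚ.<⇒≢ (sumEdges-mono-< f≤g e fij<gij) eq)

  sumEdges-cong : ∀ {f g} → (∀ i j → isEdge G i j ≡ true → f i j ≡ g i j) → sumEdges G f ≡ sumEdges G g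
  sumEdges-cong {f} {g} f≡g = cong sumℚ (map-cong (λ i → cong sumℚ (map-cong (term-≡ i) V)) V)
    where
    term-≡ : ∀ i j → edgeTerm f i j ≡ edgeTerm g i j
    term-≡ i j with isEdge G i j in e
    ... | true  = f≡g i j e
    ... | false = refl

  private
    indicator : (Fin (n G) → Fin (n G) → Bool) → Fin (n G) → Fin (n G) → ℕ
    indicator P i j = if isEdge G i j ∧ P i j then 1 else 0

    indicator≤countEdges : ∀ P i j → indicator P i j ℕ.≤ countEdges G P
    indicator≤countEdges P i j = ℕₚ.≤-trans (≤-sumℕ (indicator P i) V (∈-allFin j))
      (≤-sumℕ (λ i → sumℕ (map (indicator P i) V)) V (∈-allFin i))

  countEdges≡0⇒ : ∀ P → countEdges G P ≡ 0 → ∀ {i j} → isEdge G i j ≡ true → P i j ≡ false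
  countEdges≡0⇒ P none {i} {j} e with P i j | indicator≤countEdges P i j
  ... | false | _ = refl
  ... | true  | one≤count rewrite e = contradiction (subst (1 ℕ.≤_) none one≤count) λ ()

  countEdges>0⇒ : ∀ P → 0 ℕ.< countEdges G P → ∃₂ λ i j → isEdge G i j ≡ true × P i j ≡ true
  countEdges>0⇒ P pos with sumℕ>0⇒ _ V pos
  ... | i , row-pos with sumℕ>0⇒ (indicator P i) V row-pos
  ...   | j , ij-pos with isEdge G i j in e | P i j in p | ij-pos
  ...     | true  | true  | _  = i , j , e , p
  ...     | true  | false | ()
  ...     | false | _     | ()

  countEdges-complement : ∀ P → numEdges G ≡ countEdges G P ℕ.+ countEdges G (λ i j → not (P i j))
  countEdges-complement P = trans
    (cong sumℕ (map-cong (λ i → trans (cong sumℕ (map-cong (split i) V)) (sumℕ-+ _ _ V)) V))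
    (sumℕ-+ _ _ V)
    where
    split : ∀ i j → indicator (λ _ _ → true) i j ≡ indicator P i j ℕ.+ indicator (λ i j → not (P i j)) i j
    split i j with isEdge G i j | P i j
    ... | true  | true  = refl
    ... | true  | false = refl
    ... | false | _     = refl

  sumEdges-if : ∀ P a b → sumEdges G (λ i j → if P i j then a else b)
    ≡ a * fromℕ (countEdges G P) + b * fromℕ (countEdges G (λ i j → not (P i j)))
  sumEdges-if P a b = trans
    (cong sumℚ (map-cong (λ i → trans (cong sumℚ (map-cong (split i) V)) (sumℚ-linear a b _ _ V)) V))
    (sumℚ-linear a b _ _ V)
    where
    split : ∀ i j → edgeTerm (λ i j → if P i j then a else b) i j
      ≡ a * fromℕ (indicator P i j) + b * fromℕ (indicator (λ i j → not (P i j)) i j)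
    split i j with isEdge G i j | P i j
    ... | true  | true  = sym (trans (cong₂ _+_ (ℚₚ.*-identityʳ a) (ℚₚ.*-zeroʳ b)) (ℚₚ.+-identityʳ a))
    ... | true  | false = sym (trans (cong₂ _+_ (ℚₚ.*-zeroʳ a) (ℚₚ.*-identityʳ b)) (ℚₚ.+-identityˡ b))
    ... | false | _     = sym (trans (cong₂ _+_ (ℚₚ.*-zeroʳ a) (ℚₚ.*-zeroʳ b)) (ℚₚ.+-identityʳ 0ℚ))

  private
    sameDeg unequalDeg : Fin (n G) → Fin (n G) → Bool
    sameDeg i j = d i ≡ᵇ d j
    unequalDeg i j = not (sameDeg i j)

  numEdges∸numEqEdges : numEdges G ∸ numEqEdges G ≡ countEdges G unequalDeg
  numEdges∸numEqEdges =
    trans (cong (_∸ numEqEdges G) (countEdges-complement sameDeg)) (ℕₚ.m+n∸m≡n (numEqEdges G) _)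

  isddBound≡sumEdges : isddBound G ≡ sumEdges G (λ i j → edgeBound Δ (d i) (d j))
  isddBound≡sumEdges = begin
    isddBound G
      ≡⟨ cong₂ _+_ (sym (½*fromℕ (numEqEdges G)))
                   (cong (λ t → isdd Δ (Δ ∸ 1) * fromℕ t) numEdges∸numEqEdges) ⟩
    ½ * fromℕ (numEqEdges G) + isdd Δ (Δ ∸ 1) * fromℕ (countEdges G unequalDeg)
      ≡⟨ sym (sumEdges-if sameDeg ½ (isdd Δ (Δ ∸ 1))) ⟩
    sumEdges G (λ i j → edgeBound Δ (d i) (d j)) ∎
    where open ≡-Reasoning

  isdd≤edgeBound-onEdges : ∀ i j → isEdge G i j ≡ true → isdd (d i) (d j) ≤ edgeBound Δ (d i) (d j)
  isdd≤edgeBound-onEdges i j e =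
    isdd≤edgeBound Δ (adj⇒deg>0 (isEdge⇒adj e)) (deg≤maxDeg i) (deg≤maxDeg j)

  ISDD≤isddBound : ISDD G ≤ isddBound G
  ISDD≤isddBound = subst (ISDD G ≤_) (sym isddBound≡sumEdges) (sumEdges-mono isdd≤edgeBound-onEdges)

  isEdge⇒adj-lift : {R : Fin (n G) → Fin (n G) → Set} → (∀ {i j} → R i j → R j i) →
    (∀ {i j} → isEdge G i j ≡ true → R i j) → ∀ {i j} → adj G i j ≡ true → R i j
  isEdge⇒adj-lift R-sym onEdges a with adj⇒isEdge a
  ... | inj₁ e = onEdges e
  ... | inj₂ e = R-sym (onEdges e)

  ExtremalEdges : Set
  ExtremalEdges = ∀ {i j} → adj G i j ≡ true → Extremal Δ (d i) (d j)

  ISDD≡isddBound⇒ExtremalEdges : ISDD G ≡ isddBound G → ExtremalEdges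
  ISDD≡isddBound⇒ExtremalEdges eq = isEdge⇒adj-lift Extremal-sym λ {i} {j} e →
    isdd≡edgeBound⇒Extremal Δ (deg≤maxDeg i) (deg≤maxDeg j)
      (sumEdges-≡⇒≡ isdd≤edgeBound-onEdges (trans eq isddBound≡sumEdges) e)

  ExtremalEdges⇒ISDD≡isddBound : ExtremalEdges → ISDD G ≡ isddBound G
  ExtremalEdges⇒ISDD≡isddBound extremal = trans
    (sumEdges-cong λ i j e →
      Extremal⇒isdd≡edgeBound Δ (adj⇒deg>0 (isEdge⇒adj e)) (extremal (isEdge⇒adj e)))
    (sym isddBound≡sumEdges)

  Reachable-closed : {P : Fin (n G) → Set} → (∀ {i j} → adj G i j ≡ true → P j → P i) →
    ∀ {i j} → Reachable G i j → P j → P i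
  Reachable-closed closed here       pj = pj
  Reachable-closed closed (step a r) pj = closed a (Reachable-closed closed r pj)

  connected-sameDeg⇒Regular : Connected G → (∀ {i j} → adj G i j ≡ true → d i ≡ d j) → Regular G
  connected-sameDeg⇒Regular conn same i j =
    Reachable-closed {λ v → d v ≡ d j} (λ a dv≡dj → trans (same a) dv≡dj) (conn i j) refl

  connected⇒NearMax : Connected G → ExtremalEdges → ∀ {v₀} → NearMax Δ (d v₀) → ∀ v → NearMax Δ (d v)
  connected⇒NearMax conn extremal near₀ v =
    Reachable-closed (λ a → NearMax-closed (extremal a)) (conn v _) near₀

  NearMax⇒SemiregularBipartite : (∀ v → NearMax Δ (d v)) → (∀ {i j} → adj G i j ≡ true → d i ≢ d j) →
    SemiregularBipartite G Δ (Δ ∸ 1)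
  NearMax⇒SemiregularBipartite near unequal = colour , alternating , (λ _ → ≡ᵇ≡true⇒≡)
    , λ v c≡false → NearMax-≢⇒≡∸1 (near v) (≡ᵇ≡false⇒≢ c≡false)
    where
    colour : Fin (n G) → Bool
    colour v = d v ≡ᵇ Δ
    alternating : ∀ i j → adj G i j ≡ true → colour i ≡ not (colour j)
    alternating i j a with d i ≡ᵇ Δ | ≡ᵇ-reflects (d i) Δ | d j ≡ᵇ Δ | ≡ᵇ-reflects (d j) Δ
    ... | true  | ofʸ di≡Δ | true  | ofʸ dj≡Δ = contradiction (trans di≡Δ (sym dj≡Δ)) (unequal a)
    ... | true  | _        | false | _        = refl
    ... | false | _        | true  | _        = refl
    ... | false | ofⁿ di≢Δ | false | ofⁿ dj≢Δ =
      contradiction (trans (NearMax-≢⇒≡∸1 (near i) di≢Δ) (sym (NearMax-≢⇒≡∸1 (near j) dj≢Δ))) (unequal a)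

  Structure⇒ExtremalEdges : Regular G ⊎ SemiregularBipartite G Δ (Δ ∸ 1) ⊎ InΓ₂ G → ExtremalEdges
  Structure⇒ExtremalEdges (inj₁ regular) {i} {j} _ = inj₁ (regular i j)
  Structure⇒ExtremalEdges (inj₂ (inj₁ (colour , alternating , colour-true , colour-false))) {i} {j} a
    with colour i in ci | alternating i j a
  ... | true  | cj = inj₂ (inj₁ (colour-true i ci , colour-false j (not-injective {colour j} {false} (sym cj))))
  ... | false | cj = inj₂ (inj₂ (colour-false i ci , colour-true j (not-injective {colour j} {true} (sym cj))))
  Structure⇒ExtremalEdges (inj₂ (inj₂ (_ , _ , edgeDegrees))) a with edgeDegrees _ _ a
  ... | inj₁ (di≡Δ , dj≡Δ)                 = inj₁ (trans di≡Δ (sym dj≡Δ))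
  ... | inj₂ (inj₁ (di≡Δ∸1 , dj≡Δ∸1))      = inj₁ (trans di≡Δ∸1 (sym dj≡Δ∸1))
  ... | inj₂ (inj₂ (inj₁ degrees))         = inj₂ (inj₁ degrees)
  ... | inj₂ (inj₂ (inj₂ degrees))         = inj₂ (inj₂ degrees)

  unequalEdge⇒NearMax : Connected G → ExtremalEdges → 0 ℕ.< countEdges G unequalDeg →
    ∀ v → NearMax Δ (d v)
  unequalEdge⇒NearMax conn extremal some with countEdges>0⇒ unequalDeg some
  ... | _ , _ , e₀ , unequal₀ = connected⇒NearMax conn extremal
    (Extremal⇒NearMax (extremal (isEdge⇒adj e₀)) (≡ᵇ≡false⇒≢ (not-injective unequal₀)))

  ExtremalEdges⇒Structure : Connected G → ExtremalEdges →
    Regular G ⊎ SemiregularBipartite G Δ (Δ ∸ 1) ⊎ InΓ₂ G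
  ExtremalEdges⇒Structure conn extremal with countEdges G unequalDeg ℕ.≟ 0
  ... | yes none = inj₁ (connected-sameDeg⇒Regular conn (isEdge⇒adj-lift sym λ e →
                     ≡ᵇ≡true⇒≡ (not-injective (countEdges≡0⇒ unequalDeg none e))))
  ... | no some
    with unequalEdge⇒NearMax conn extremal (ℕₚ.n≢0⇒n>0 some) | numEqEdges G ℕ.≟ 0
  ...   | near | yes none = inj₂ (inj₁ (NearMax⇒SemiregularBipartite near (isEdge⇒adj-lift ≢-sym λ e →
                              ≡ᵇ≡false⇒≢ (countEdges≡0⇒ sameDeg none e))))
  ...   | near | no some′ = inj₂ (inj₂ (ℕₚ.n≢0⇒n>0 some′
                              , subst (0 ℕ.<_) (sym numEdges∸numEqEdges) (ℕₚ.n≢0⇒n>0 some)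
                              , λ i j _ → NearMax-pair (near i) (near j)))

  ISDD≡isddBound⇔ExtremalEdges : ISDD G ≡ isddBound G ⇔ ExtremalEdges
  ISDD≡isddBound⇔ExtremalEdges = mk⇔ ISDD≡isddBound⇒ExtremalEdges ExtremalEdges⇒ISDD≡isddBound

  ExtremalEdges⇔Structure : Connected G →
    ExtremalEdges ⇔ (Regular G ⊎ SemiregularBipartite G Δ (Δ ∸ 1) ⊎ InΓ₂ G)
  ExtremalEdges⇔Structure conn = mk⇔ (ExtremalEdges⇒Structure conn) Structure⇒ExtremalEdges

theorem2p6 : (G : Graph) →
    (ISDD G ≤ isddBound G)
    × (Connected G →
        (ISDD G ≡ isddBound G ⇔
          (Regular G ⊎ SemiregularBipartite G (maxDeg G) (maxDeg G Data.Nat.∸ 1) ⊎ InΓ₂ G)))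
theorem2p6 G = ISDD≤isddBound G , λ conn →
  ⇔.trans (ISDD≡isddBound⇔ExtremalEdges G) (ExtremalEdges⇔Structure G conn)
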